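{- Let $p$ be an odd prime and let $\alpha>1$ be any integer with $\gcd(\alpha,p)=1$. Then for all $a\in\mathbb{N}$ (with $a\ge1$), $$S_p^1(a)\le 4\,a^{\log_p\left(\frac{p+1}{2}\right)}.$$
   Context: A base-$p$ digit $d\in\{0,\dots,p-1\}$ is called large if $d>p/2$. For $a,n\in\mathbb{N}$, $S_p^n(a)=\#\{0\le s<a : \text{the base- }p\text{ representation of }\alpha^s\text{ contains fewer than }n\text{ large digits}\}$; in particular $S_p^1(a)$ counts $0\le s<a$ such that $\alpha^s$ has no large base-$p$ digit. -}

module Defs where

open import Data.Nat using (ℕ; zero; suc; _+_; _*_; _^_; _≤_; _<_; _<?_)
open import Data.Nat.DivMod using (_%_; _/_)
import Relation.Nullary
open import Data.List using (List; []; _∷_; length; filter; upTo)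

-- With fuel = x this is the full expansion whenever p ≥ 2 (x has at most x digits).
-- Base 0 is a degenerate case returning no digits (never used: p is prime).
digitsF : ℕ → ℕ → ℕ → List ℕ
digitsF zero    _        _ = []
digitsF (suc b) zero     _ = []
digitsF (suc b) (suc f)  zero = []
digitsF (suc b) (suc f)  x@(suc _) = (x % suc b) ∷ digitsF (suc b) f (x / suc b)

digits : ℕ → ℕ → List ℕ
digits p x = digitsF p x x

-- a digit d is large iff d > p/2, i.e. p < 2d
numLarge : ℕ → List ℕ → ℕ
numLarge p [] = 0
numLarge p (d ∷ ds) with p <? 2 * d
... | Relation.Nullary.yes _ = suc (numLarge p ds)
... | Relation.Nullary.no  _ = numLarge p ds

S : (p α n a : ℕ) → ℕ
S p α n a = length (filter (λ s → numLarge p (digits p (α ^ s)) <? n) (upTo a))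

-- "X ≤ 4 · a^(log_p((p+1)/2))" expressed without reals:
-- for all m ≥ 1 and n with a^m ≤ p^n (i.e. n/m ≥ log_p a),
-- (X/4)^m ≤ ((p+1)/2)^n, i.e. X^m · 2^n ≤ 4^m · (p+1)^n.
LeFourPowLog : (X a p : ℕ) → Set
LeFourPowLog X a p =
  (m n : ℕ) → 1 ≤ m → a ^ m ≤ p ^ n → X ^ m * 2 ^ n ≤ 4 ^ m * (p + 1) ^ n

-- Write p = 2t + 1 and h = t + 1 = (p + 1) / 2.  Since p ∤ α, some power α ^ d with
-- 1 ≤ d ≤ p equals 1 + p ^ (V + 1) · u with p ∤ u, and since p is odd, raising to the p-th
-- power gives α ^ (d p ^ j) = 1 + p ^ (V + 1 + j) · u_j with p ∤ u_j.  So as i runs through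
-- 0, …, p - 1, the base-p digits of α ^ (s + i d p ^ j) below position V + 1 + j stay fixed
-- while the digit at that position takes p distinct values, at most h of them small.  By
-- induction on J, a window of d p ^ J consecutive exponents holds at most d h ^ J exponents
-- whose digits at positions V + 1, …, V + J are all small, hence
-- S(a) p ^ J ≤ h ^ J (a + p ^ (J + 1)) for every J.  Applied at scale k = ⌊n / m⌋ when
-- a ^ m ≤ p ^ n, this reduces the claim to the concavity estimate
-- (A + 1) / 2 ≤ ((p + 1) / 2) ^ r for A ≤ p ^ r, 0 ≤ r ≤ 1, a consequence of weighted AM–GM.
module Submission where

import Algebra.Properties.CommutativeSemigroup as CommSemigroupProperties
open import Data.Fin using (Fin; toℕ; fromℕ<)
import Data.Fin.Properties as Finₚ
open import Data.List using (filter; applyUpTo; upTo; length; _∷_)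
open import Data.List.Properties using (length-filter; length-upTo)
open import Data.Nat
open import Data.Nat.Combinatorics using (_C_; nC1≡n; nCk+nC[k+1]≡[n+1]C[k+1])
open import Data.Nat.DivMod
open import Data.Nat.Divisibility
open import Data.Nat.GCD using (gcd; gcd-greatest)
open import Data.Nat.Induction using (<-wellFounded)
open import Data.Nat.Primality using (Prime; euclidsLemma; prime⇒nonTrivial; prime⇒irreducible)
open import Data.Nat.Properties
open import Data.Nat.Tactic.RingSolver using (solve-∀)
open import Data.Product using (∃; ∃₂; _×_; _,_; proj₁; proj₂)
open import Data.Sum using (inj₁; inj₂; [_,_]′)
open import Function using (id)
open import Induction.WellFounded using (Acc; acc)
open import Relation.Binary.Definitions using (tri<; tri≈; tri>)
open import Relation.Binary.PropositionalEquality
open import Relation.Nullary using (¬_; Dec; yes; no; contradiction)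
open import Relation.Unary using (Decidable)
open import Defs

open CommSemigroupProperties +-commutativeSemigroup using (interchange)
open CommSemigroupProperties *-commutativeSemigroup
  using (x∙yz≈y∙xz; x∙yz≈xz∙y; xy∙z≈xz∙y; xy∙z≈zx∙y)

^-distribʳ-* : ∀ m n o → (m * n) ^ o ≡ m ^ o * n ^ o
^-distribʳ-* m n zero    = refl
^-distribʳ-* m n (suc o) =
  trans (cong (m * n *_) (^-distribʳ-* m n o)) ([m*n]*[o*p]≡[m*o]*[n*p] m n (m ^ o) (n ^ o))

n^n>0 : ∀ n → 0 < n ^ n
n^n>0 zero    = z<s
n^n>0 (suc n) = m^n>0 (suc n) (suc n)

bernoulli-lower : ∀ z δ n → z ^ suc n + suc n * z ^ n * δ ≤ (z + δ) ^ suc n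
bernoulli-lower z δ zero    = ≤-reflexive (expand z δ)
  where
  expand : ∀ z δ → z * 1 + 1 * 1 * δ ≡ (z + δ) * 1
  expand = solve-∀
bernoulli-lower z δ (suc n) = begin
  z ^ suc (suc n) + suc (suc n) * z ^ suc n * δ
    ≤⟨ m≤m+n _ (suc n * z ^ n * δ * δ) ⟩
  z ^ suc (suc n) + suc (suc n) * z ^ suc n * δ + suc n * z ^ n * δ * δ
    ≡⟨ factor z δ (z ^ n) n ⟩
  (z + δ) * (z ^ suc n + suc n * z ^ n * δ)
    ≤⟨ *-monoʳ-≤ (z + δ) (bernoulli-lower z δ n) ⟩
  (z + δ) ^ suc (suc n) ∎
  where
  open ≤-Reasoning
  factor : ∀ z δ A n → z * (z * A) + suc (suc n) * (z * A) * δ + suc n * A * δ * δ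
                     ≡ (z + δ) * (z * A + suc n * A * δ)
  factor = solve-∀

bernoulli-upper : ∀ w ε n → (w + ε) ^ suc n ≤ w ^ suc n + suc n * (w + ε) ^ n * ε
bernoulli-upper w ε zero    = ≤-reflexive (expand w ε)
  where
  expand : ∀ w ε → (w + ε) * 1 ≡ w * 1 + 1 * 1 * ε
  expand = solve-∀
bernoulli-upper w ε (suc n) = begin
  (w + ε) * (w + ε) ^ suc n
    ≤⟨ *-monoʳ-≤ (w + ε) (bernoulli-upper w ε n) ⟩
  (w + ε) * (w ^ suc n + suc n * (w + ε) ^ n * ε)
    ≡⟨ expand w ε (w ^ n) ((w + ε) ^ n) n ⟩
  w ^ suc (suc n) + ε * w ^ suc n + suc n * (w + ε) ^ suc n * ε
    ≤⟨ +-monoˡ-≤ _ (+-monoʳ-≤ (w ^ suc (suc n)) (*-monoʳ-≤ ε (^-monoˡ-≤ (suc n) (m≤m+n w ε)))) ⟩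
  w ^ suc (suc n) + ε * (w + ε) ^ suc n + suc n * (w + ε) ^ suc n * ε
    ≡⟨ collect (w ^ suc (suc n)) ε ((w + ε) ^ suc n) n ⟩
  w ^ suc (suc n) + suc (suc n) * (w + ε) ^ suc n * ε ∎
  where
  open ≤-Reasoning
  expand : ∀ w ε A B n → (w + ε) * (w * A + suc n * B * ε)
                       ≡ w * (w * A) + ε * (w * A) + suc n * ((w + ε) * B) * ε
  expand = solve-∀
  collect : ∀ W ε C n → W + ε * C + suc n * C * ε ≡ W + suc (suc n) * C * ε
  collect = solve-∀

amgm-replicate : ∀ n x y → suc n ^ suc n * x ^ n * y ≤ (n * x + y) ^ suc n
amgm-replicate n x y with ≤-total x y
... | inj₁ x≤y with m≤n⇒∃[o]m+o≡n x≤y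
...   | δ , refl = begin
  suc n ^ suc n * x ^ n * (x + δ)
    ≡⟨ split (suc n) x (suc n ^ n) (x ^ n) δ ⟩
  suc n ^ suc n * x ^ suc n + suc n * (suc n ^ n * x ^ n) * δ
    ≡⟨ sym (cong₂ (λ u v → u + suc n * v * δ) (^-distribʳ-* (suc n) x (suc n)) (^-distribʳ-* (suc n) x n)) ⟩
  (suc n * x) ^ suc n + suc n * (suc n * x) ^ n * δ
    ≤⟨ bernoulli-lower (suc n * x) δ n ⟩
  (suc n * x + δ) ^ suc n
    ≡⟨ cong (_^ suc n) (regroup n x δ) ⟩
  (n * x + (x + δ)) ^ suc n ∎
  where
  open ≤-Reasoning
  split : ∀ s x S X δ → s * S * X * (x + δ) ≡ s * S * (x * X) + s * (S * X) * δ
  split = solve-∀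
  regroup : ∀ n x δ → suc n * x + δ ≡ n * x + (x + δ)
  regroup = solve-∀
amgm-replicate n x y | inj₂ y≤x with m≤n⇒∃[o]m+o≡n y≤x
...   | ε , refl = +-cancelʳ-≤ (suc n * (w + ε) ^ n * ε) _ _ (begin
  suc n ^ suc n * (y + ε) ^ n * y + suc n * (w + ε) ^ n * ε
    ≡⟨ cong (λ v → suc n ^ suc n * (y + ε) ^ n * y + suc n * v ^ n * ε) w+ε≡ ⟩
  suc n ^ suc n * (y + ε) ^ n * y + suc n * (suc n * (y + ε)) ^ n * ε
    ≡⟨ cong (λ v → suc n ^ suc n * (y + ε) ^ n * y + suc n * v * ε) (^-distribʳ-* (suc n) (y + ε) n) ⟩
  suc n ^ suc n * (y + ε) ^ n * y + suc n * (suc n ^ n * (y + ε) ^ n) * ε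
    ≡⟨ merge (suc n) (suc n ^ n) y ε ((y + ε) ^ n) ⟩
  suc n ^ suc n * (y + ε) ^ suc n
    ≡⟨ sym (^-distribʳ-* (suc n) (y + ε) (suc n)) ⟩
  (suc n * (y + ε)) ^ suc n
    ≡⟨ cong (_^ suc n) (sym w+ε≡) ⟩
  (w + ε) ^ suc n
    ≤⟨ bernoulli-upper w ε n ⟩
  w ^ suc n + suc n * (w + ε) ^ n * ε ∎)
  where
  open ≤-Reasoning
  w = n * (y + ε) + y
  w+ε≡ : w + ε ≡ suc n * (y + ε)
  w+ε≡ = regroup n y ε
    where
    regroup : ∀ n y ε → n * (y + ε) + y + ε ≡ suc n * (y + ε)
    regroup = solve-∀
  merge : ∀ s S y ε A → s * S * A * y + s * (S * A) * ε ≡ s * S * ((y + ε) * A)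
  merge = solve-∀

amgm-extend : ∀ N S y → suc N ^ suc N * S ^ N * y ≤ N ^ N * (S + y) ^ suc N
amgm-extend zero    S y = +-monoˡ-≤ 0 (≤-trans (m≤n+m y S) (≤-reflexive (sym (*-identityʳ (S + y)))))
amgm-extend (suc n) S y = *-cancelˡ-≤ (suc n) (begin
  suc n * (suc (suc n) ^ suc (suc n) * S ^ suc n * y)
    ≡⟨ move (suc n) (suc (suc n) ^ suc (suc n)) (S ^ suc n) y ⟩
  suc (suc n) ^ suc (suc n) * S ^ suc n * (suc n * y)
    ≤⟨ amgm-replicate (suc n) S (suc n * y) ⟩
  (suc n * S + suc n * y) ^ suc (suc n)
    ≡⟨ cong (_^ suc (suc n)) (sym (*-distribˡ-+ (suc n) S y)) ⟩
  (suc n * (S + y)) ^ suc (suc n)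
    ≡⟨ ^-distribʳ-* (suc n) (S + y) (suc (suc n)) ⟩
  suc n * suc n ^ suc n * (S + y) ^ suc (suc n)
    ≡⟨ *-assoc (suc n) (suc n ^ suc n) _ ⟩
  suc n * (suc n ^ suc n * (S + y) ^ suc (suc n)) ∎)
  where
  open ≤-Reasoning
  move : ∀ k P A y → k * (P * A * y) ≡ P * A * (k * y)
  move = solve-∀

weighted-amgm : ∀ e f x y → (e + f) ^ (e + f) * (x ^ e * y ^ f) ≤ (e * x + f * y) ^ (e + f)
weighted-amgm e zero    x y
  rewrite +-identityʳ e | +-identityʳ (e * x) | *-identityʳ (x ^ e) =
  ≤-reflexive (sym (^-distribʳ-* e x e))
weighted-amgm e (suc f) x y = *-cancelˡ-≤ (N ^ N) {{>-nonZero (n^n>0 N)}} (begin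
  N ^ N * ((e + suc f) ^ (e + suc f) * (x ^ e * y ^ suc f))
    ≡⟨ cong (λ k → N ^ N * (k ^ k * (x ^ e * y ^ suc f))) (+-suc e f) ⟩
  N ^ N * (suc N ^ suc N * (x ^ e * (y * y ^ f)))
    ≡⟨ move (N ^ N) (suc N ^ suc N) (x ^ e) (y ^ f) y ⟩
  suc N ^ suc N * (N ^ N * (x ^ e * y ^ f)) * y
    ≤⟨ *-monoˡ-≤ y (*-monoʳ-≤ (suc N ^ suc N) (weighted-amgm e f x y)) ⟩
  suc N ^ suc N * total ^ N * y
    ≤⟨ amgm-extend N total y ⟩
  N ^ N * (total + y) ^ suc N
    ≡⟨ cong₂ (λ u k → N ^ N * u ^ k) (regroup e f x y) (sym (+-suc e f)) ⟩
  N ^ N * (e * x + suc f * y) ^ (e + suc f) ∎)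
  where
  open ≤-Reasoning
  N = e + f
  total = e * x + f * y
  move : ∀ Q P X Y y → Q * (P * (X * (y * Y))) ≡ P * (Q * (X * Y)) * y
  move = solve-∀
  regroup : ∀ e f x y → e * x + f * y + y ≡ e * x + suc f * y
  regroup = solve-∀

-- Read a ^ m * K ≤ b ^ m as a · K^(1/m) ≤ b: such bounds can be added.
root-bound-+ : ∀ m K {a b c d} → 0 < b → 0 < d →
               a ^ m * K ≤ b ^ m → c ^ m * K ≤ d ^ m → (a + c) ^ m * K ≤ (b + d) ^ m
root-bound-+ m K {a} {b} {c} {d} b>0 d>0 ab cd = [ (λ cb≤ad → ordered b>0 cb≤ad ab)
  , (λ ad≤cb → subst₂ (λ x y → x ^ m * K ≤ y ^ m) (+-comm c a) (+-comm d b) (ordered d>0 ad≤cb cd))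
  ]′ (≤-total (c * b) (a * d))
  where
  ordered : ∀ {a b c d} → 0 < b → c * b ≤ a * d → a ^ m * K ≤ b ^ m → (a + c) ^ m * K ≤ (b + d) ^ m
  ordered {a} {b} {c} {d} b>0 cb≤ad ab = *-cancelˡ-≤ (b ^ m) {{m^n≢0 b m {{>-nonZero b>0}}}} (begin
    b ^ m * ((a + c) ^ m * K)     ≡⟨ swap (b ^ m) ((a + c) ^ m) K ⟩
    (a + c) ^ m * b ^ m * K       ≡⟨ cong (_* K) (sym (^-distribʳ-* (a + c) b m)) ⟩
    ((a + c) * b) ^ m * K         ≤⟨ *-monoˡ-≤ K (^-monoˡ-≤ m mediant) ⟩
    (a * (b + d)) ^ m * K         ≡⟨ cong (_* K) (^-distribʳ-* a (b + d) m) ⟩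
    a ^ m * (b + d) ^ m * K       ≡⟨ sym (swap ((b + d) ^ m) (a ^ m) K) ⟩
    (b + d) ^ m * (a ^ m * K)     ≤⟨ *-monoʳ-≤ ((b + d) ^ m) ab ⟩
    (b + d) ^ m * b ^ m           ≡⟨ *-comm ((b + d) ^ m) (b ^ m) ⟩
    b ^ m * (b + d) ^ m           ∎)
    where
    open ≤-Reasoning
    mediant : (a + c) * b ≤ a * (b + d)
    mediant = begin
      (a + c) * b   ≡⟨ *-distribʳ-+ b a c ⟩
      a * b + c * b ≤⟨ +-monoʳ-≤ (a * b) cb≤ad ⟩
      a * b + a * d ≡⟨ sym (*-distribˡ-+ a b d) ⟩
      a * (b + d)   ∎
    swap : ∀ x y z → x * (y * z) ≡ y * x * z
    swap = solve-∀

weighted-sum>0 : ∀ e f {x y} → 0 < e + f → 0 < x → 0 < y → 0 < e * x + f * y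
weighted-sum>0 (suc e) f       _ x>0 _   = ≤-trans (*-mono-≤ (s≤s (z≤n {e})) x>0) (m≤m+n _ _)
weighted-sum>0 zero    (suc f) _ _   y>0 = *-mono-≤ (s≤s (z≤n {f})) y>0

-- With A = a / U and r = e / m this is the concavity estimate (A + 1) / 2 ≤ ((p + 1) / 2) ^ r
-- for A ≤ p ^ r.  Put K = 2 ^ e * (p + 1) ^ (m - e): weighted AM–GM bounds both A · K^(1/m)
-- and K^(1/m) by weighted means of 2p, p + 1 and of 2, p + 1, and these add up to 2 (p + 1).
power-mean : ∀ p e m a U → 0 < p → 0 < U → 0 < m → e ≤ m → a ^ m ≤ U ^ m * p ^ e →
             (a + U) ^ m * 2 ^ e ≤ 2 ^ m * U ^ m * (p + 1) ^ e
power-mean p e m a U p>0 U>0 m>0 e≤m a^m≤ with m≤n⇒∃[o]m+o≡n e≤m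
... | f , refl = *-cancelʳ-≤ _ _ (M ^ M * (p + 1) ^ f) {{M^M*[p+1]^f≢0}} (begin
  (a + U) ^ M * 2 ^ e * (M ^ M * (p + 1) ^ f)          ≡⟨ lhs ⟩
  (a * M + U * M) ^ M * K                              ≤⟨ root-bound-+ M K (U*-pos L₁>0) (U*-pos L₂>0) a-bound U-bound ⟩
  (U * L₁ + U * L₂) ^ M                                ≡⟨ rhs ⟩
  2 ^ M * U ^ M * (p + 1) ^ e * (M ^ M * (p + 1) ^ f)  ∎)
  where
  open ≤-Reasoning
  M  = e + f
  K  = 2 ^ e * (p + 1) ^ f
  L₁ = e * (2 * p) + f * (p + 1)
  L₂ = e * 2 + f * (p + 1)
  p+1>0 : 0 < p + 1
  p+1>0 = ≤-trans p>0 (m≤m+n p 1)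
  M^M*[p+1]^f≢0 : NonZero (M ^ M * (p + 1) ^ f)
  M^M*[p+1]^f≢0 = m*n≢0 _ _ {{>-nonZero (n^n>0 M)}} {{m^n≢0 (p + 1) f {{>-nonZero p+1>0}}}}
  L₁>0 : 0 < L₁
  L₁>0 = weighted-sum>0 e f m>0 (*-mono-≤ (s≤s (z≤n {1})) p>0) p+1>0
  L₂>0 : 0 < L₂
  L₂>0 = weighted-sum>0 e f m>0 z<s p+1>0
  U*-pos : ∀ {x} → 0 < x → 0 < U * x
  U*-pos = *-mono-≤ U>0
  collect-2^e : ∀ A B C D E → A * B * C * (D * E) ≡ A * (C * ((D * B) * E))
  collect-2^e = solve-∀
  a-bound : (a * M) ^ M * K ≤ (U * L₁) ^ M
  a-bound = begin
    (a * M) ^ M * K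
      ≡⟨ cong (_* K) (^-distribʳ-* a M M) ⟩
    a ^ M * M ^ M * K
      ≤⟨ *-monoˡ-≤ K (*-monoˡ-≤ (M ^ M) a^m≤) ⟩
    U ^ M * p ^ e * M ^ M * (2 ^ e * (p + 1) ^ f)
      ≡⟨ collect-2^e (U ^ M) (p ^ e) (M ^ M) (2 ^ e) ((p + 1) ^ f) ⟩
    U ^ M * (M ^ M * ((2 ^ e * p ^ e) * (p + 1) ^ f))
      ≡⟨ cong (λ v → U ^ M * (M ^ M * (v * (p + 1) ^ f))) (sym (^-distribʳ-* 2 p e)) ⟩
    U ^ M * (M ^ M * ((2 * p) ^ e * (p + 1) ^ f))
      ≤⟨ *-monoʳ-≤ (U ^ M) (weighted-amgm e f (2 * p) (p + 1)) ⟩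
    U ^ M * L₁ ^ M
      ≡⟨ sym (^-distribʳ-* U L₁ M) ⟩
    (U * L₁) ^ M ∎
  U-bound : (U * M) ^ M * K ≤ (U * L₂) ^ M
  U-bound = begin
    (U * M) ^ M * K     ≡⟨ cong (_* K) (^-distribʳ-* U M M) ⟩
    U ^ M * M ^ M * K   ≡⟨ *-assoc (U ^ M) (M ^ M) K ⟩
    U ^ M * (M ^ M * K) ≤⟨ *-monoʳ-≤ (U ^ M) (weighted-amgm e f 2 (p + 1)) ⟩
    U ^ M * L₂ ^ M      ≡⟨ sym (^-distribʳ-* U L₂ M) ⟩
    (U * L₂) ^ M        ∎
  swap-middle : ∀ A B C D → A * B * (C * D) ≡ A * C * (B * D)
  swap-middle = solve-∀
  lhs : (a + U) ^ M * 2 ^ e * (M ^ M * (p + 1) ^ f) ≡ (a * M + U * M) ^ M * K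
  lhs = begin-equality
    (a + U) ^ M * 2 ^ e * (M ^ M * (p + 1) ^ f) ≡⟨ swap-middle ((a + U) ^ M) (2 ^ e) (M ^ M) ((p + 1) ^ f) ⟩
    (a + U) ^ M * M ^ M * K                     ≡⟨ cong (_* K) (sym (^-distribʳ-* (a + U) M M)) ⟩
    ((a + U) * M) ^ M * K                       ≡⟨ cong (λ v → v ^ M * K) (*-distribʳ-+ M a U) ⟩
    (a * M + U * M) ^ M * K                     ∎
  sum-of-means : ∀ U e f p → U * (e * (2 * p) + f * (p + 1)) + U * (e * 2 + f * (p + 1))
                           ≡ 2 * U * (p + 1) * (e + f)
  sum-of-means = solve-∀
  swap-last : ∀ A B C D → A * (B * C) * D ≡ A * B * (D * C)
  swap-last = solve-∀
  rhs : (U * L₁ + U * L₂) ^ M ≡ 2 ^ M * U ^ M * (p + 1) ^ e * (M ^ M * (p + 1) ^ f)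
  rhs = begin-equality
    (U * L₁ + U * L₂) ^ M
      ≡⟨ cong (_^ M) (sum-of-means U e f p) ⟩
    (2 * U * (p + 1) * M) ^ M
      ≡⟨ ^-distribʳ-* (2 * U * (p + 1)) M M ⟩
    (2 * U * (p + 1)) ^ M * M ^ M
      ≡⟨ cong (_* M ^ M) (trans (^-distribʳ-* (2 * U) (p + 1) M) (cong (_* (p + 1) ^ M) (^-distribʳ-* 2 U M))) ⟩
    2 ^ M * U ^ M * (p + 1) ^ M * M ^ M
      ≡⟨ cong (λ v → 2 ^ M * U ^ M * v * M ^ M) (^-distribˡ-+-* (p + 1) e f) ⟩
    2 ^ M * U ^ M * ((p + 1) ^ e * (p + 1) ^ f) * M ^ M
      ≡⟨ swap-last (2 ^ M * U ^ M) ((p + 1) ^ e) ((p + 1) ^ f) (M ^ M) ⟩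
    2 ^ M * U ^ M * (p + 1) ^ e * (M ^ M * (p + 1) ^ f) ∎

bound-at-scale : ∀ p h S a k e m → 0 < p → p + 1 ≡ 2 * h → 0 < m → e ≤ m →
                 S * p ^ k ≤ 2 * h ^ k * (a + p ^ k) → a ^ m ≤ (p ^ k) ^ m * p ^ e →
                 S ^ m * 2 ^ (e + k * m) ≤ 4 ^ m * (p + 1) ^ (e + k * m)
bound-at-scale p h S a k e m p>0 p+1≡2h m>0 e≤m S-bound a^m≤ =
  *-cancelˡ-≤ (U ^ m) {{m^n≢0 U m {{>-nonZero U>0}}}} (begin
  U ^ m * (S ^ m * 2 ^ (e + k * m))
    ≡⟨ cong (λ v → U ^ m * (S ^ m * v)) (^-distribˡ-+-* 2 e (k * m)) ⟩
  U ^ m * (S ^ m * (2 ^ e * T))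
    ≡⟨ reorder₁ (U ^ m) (S ^ m) (2 ^ e) T ⟩
  S ^ m * U ^ m * (T * 2 ^ e)
    ≡⟨ cong (_* (T * 2 ^ e)) (sym (^-distribʳ-* S U m)) ⟩
  (S * U) ^ m * (T * 2 ^ e)
    ≤⟨ *-monoˡ-≤ (T * 2 ^ e) (^-monoˡ-≤ m S-bound) ⟩
  (2 * h ^ k * (a + U)) ^ m * (T * 2 ^ e)
    ≡⟨ cong (_* (T * 2 ^ e)) expand ⟩
  2 ^ m * H * (a + U) ^ m * (T * 2 ^ e)
    ≡⟨ reorder₂ (2 ^ m) H ((a + U) ^ m) T (2 ^ e) ⟩
  2 ^ m * H * T * ((a + U) ^ m * 2 ^ e)
    ≤⟨ *-monoʳ-≤ (2 ^ m * H * T) (power-mean p e m a U p>0 U>0 m>0 e≤m a^m≤) ⟩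
  2 ^ m * H * T * (2 ^ m * U ^ m * (p + 1) ^ e)
    ≡⟨ reorder₃ (2 ^ m) H T (U ^ m) ((p + 1) ^ e) ⟩
  U ^ m * ((2 ^ m * 2 ^ m) * ((p + 1) ^ e * (T * H)))
    ≡⟨ cong₂ (λ u v → U ^ m * (u * ((p + 1) ^ e * v))) (sym (^-distribʳ-* 2 2 m)) (sym [p+1]^km) ⟩
  U ^ m * (4 ^ m * ((p + 1) ^ e * (p + 1) ^ (k * m)))
    ≡⟨ cong (λ v → U ^ m * (4 ^ m * v)) (sym (^-distribˡ-+-* (p + 1) e (k * m))) ⟩
  U ^ m * (4 ^ m * (p + 1) ^ (e + k * m)) ∎)
  where
  open ≤-Reasoning
  U = p ^ k
  H = h ^ (k * m)
  T = 2 ^ (k * m)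
  U>0 : 0 < U
  U>0 = m^n>0 p {{>-nonZero p>0}} k
  expand : (2 * h ^ k * (a + U)) ^ m ≡ 2 ^ m * H * (a + U) ^ m
  expand = trans (^-distribʳ-* (2 * h ^ k) (a + U) m)
                 (cong (_* (a + U) ^ m) (trans (^-distribʳ-* 2 (h ^ k) m) (cong (2 ^ m *_) (^-*-assoc h k m))))
  [p+1]^km : (p + 1) ^ (k * m) ≡ T * H
  [p+1]^km = trans (cong (_^ (k * m)) p+1≡2h) (^-distribʳ-* 2 h (k * m))
  reorder₁ : ∀ A B C D → A * (B * (C * D)) ≡ B * A * (D * C)
  reorder₁ = solve-∀
  reorder₂ : ∀ A B C D E → A * B * C * (D * E) ≡ A * B * D * (C * E)
  reorder₂ = solve-∀
  reorder₃ : ∀ A B C D V → A * B * C * (A * D * V) ≡ D * (A * A * (V * (C * B)))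
  reorder₃ = solve-∀

scale-bounds⇒LeFourPowLog : ∀ p h S a → 0 < p → p + 1 ≡ 2 * h →
                            (∀ k → S * p ^ k ≤ 2 * h ^ k * (a + p ^ k)) → LeFourPowLog S a p
scale-bounds⇒LeFourPowLog p h S a p>0 p+1≡2h bound m n m>0 a^m≤p^n =
  subst (λ n → S ^ m * 2 ^ n ≤ 4 ^ m * (p + 1) ^ n) (sym n≡e+km)
    (bound-at-scale p h S a k e m p>0 p+1≡2h m>0 (m%n≤n n m) (bound k) a^m≤)
  where
  instance
    m≢0 : NonZero m
    m≢0 = >-nonZero m>0
  k = n / m
  e = n % m
  n≡e+km : n ≡ e + k * m
  n≡e+km = m≡m%n+[m/n]*n n m
  a^m≤ : a ^ m ≤ (p ^ k) ^ m * p ^ e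
  a^m≤ = begin
    a ^ m                  ≤⟨ a^m≤p^n ⟩
    p ^ n                  ≡⟨ cong (p ^_) n≡e+km ⟩
    p ^ (e + k * m)        ≡⟨ ^-distribˡ-+-* p e (k * m) ⟩
    p ^ e * p ^ (k * m)    ≡⟨ cong (p ^ e *_) (sym (^-*-assoc p k m)) ⟩
    p ^ e * (p ^ k) ^ m    ≡⟨ *-comm (p ^ e) ((p ^ k) ^ m) ⟩
    (p ^ k) ^ m * p ^ e    ∎
    where open ≤-Reasoning

∑< : ℕ → (ℕ → ℕ) → ℕ
∑< zero    f = 0
∑< (suc n) f = f 0 + ∑< n (λ i → f (suc i))

syntax ∑< n (λ i → e) = ∑[ i < n ] e

∑-cong : ∀ n {f g : ℕ → ℕ} → (∀ i → f i ≡ g i) → ∑< n f ≡ ∑< n g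
∑-cong zero    f≡g = refl
∑-cong (suc n) f≡g = cong₂ _+_ (f≡g 0) (∑-cong n (λ i → f≡g (suc i)))

∑-mono-≤ : ∀ n {f g : ℕ → ℕ} → (∀ i → f i ≤ g i) → ∑< n f ≤ ∑< n g
∑-mono-≤ zero    f≤g = z≤n
∑-mono-≤ (suc n) f≤g = +-mono-≤ (f≤g 0) (∑-mono-≤ n (λ i → f≤g (suc i)))

∑-≤-* : ∀ n {f : ℕ → ℕ} c → (∀ {i} → i < n → f i ≤ c) → ∑< n f ≤ n * c
∑-≤-* zero    c f≤c = z≤n
∑-≤-* (suc n) c f≤c = +-mono-≤ (f≤c z<s) (∑-≤-* n c (λ i<n → f≤c (s<s i<n)))

∑-+ : ∀ n (f g : ℕ → ℕ) → ∑[ i < n ] (f i + g i) ≡ ∑< n f + ∑< n g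
∑-+ zero    f g = refl
∑-+ (suc n) f g = trans (cong (f 0 + g 0 +_) (∑-+ n (λ i → f (suc i)) (λ i → g (suc i))))
                        (interchange (f 0) (g 0) _ _)

∑-*ˡ : ∀ n c (f : ℕ → ℕ) → ∑[ i < n ] (c * f i) ≡ c * ∑< n f
∑-*ˡ zero    c f = sym (*-zeroʳ c)
∑-*ˡ (suc n) c f = trans (cong (c * f 0 +_) (∑-*ˡ n c (λ i → f (suc i)))) (sym (*-distribˡ-+ c (f 0) _))

∑-split : ∀ m n (f : ℕ → ℕ) → ∑< (m + n) f ≡ ∑< m f + ∑[ i < n ] f (m + i)
∑-split zero    n f = refl
∑-split (suc m) n f = trans (cong (f 0 +_) (∑-split m n (λ i → f (suc i)))) (sym (+-assoc (f 0) _ _))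

∑-mono-length : ∀ {m n} (f : ℕ → ℕ) → m ≤ n → ∑< m f ≤ ∑< n f
∑-mono-length {m} f m≤n with k , refl ← m≤n⇒∃[o]m+o≡n m≤n =
  subst (∑< m f ≤_) (sym (∑-split m k f)) (m≤m+n _ _)

∑-comm : ∀ m n (f : ℕ → ℕ → ℕ) → ∑[ i < m ] ∑[ j < n ] f i j ≡ ∑[ j < n ] ∑[ i < m ] f i j
∑-comm zero    n f = sym (∑-zero n)
  where
  ∑-zero : ∀ n → ∑[ j < n ] 0 ≡ 0
  ∑-zero zero    = refl
  ∑-zero (suc n) = ∑-zero n
∑-comm (suc m) n f = trans (cong (∑< n (f 0) +_) (∑-comm m n (λ i → f (suc i))))
                           (sym (∑-+ n (f 0) (λ j → ∑[ i < m ] f (suc i) j)))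

∑-blocks : ∀ k L (f : ℕ → ℕ) → ∑< (k * L) f ≡ ∑[ i < k ] ∑[ s < L ] f (i * L + s)
∑-blocks zero    L f = refl
∑-blocks (suc k) L f = begin
  ∑< (L + k * L) f                                     ≡⟨ ∑-split L (k * L) f ⟩
  ∑< L f + ∑[ x < k * L ] f (L + x)                    ≡⟨ cong (∑< L f +_) (∑-blocks k L (λ x → f (L + x))) ⟩
  ∑< L f + ∑[ i < k ] ∑[ s < L ] f (L + (i * L + s))
    ≡⟨ cong (∑< L f +_) (∑-cong k (λ i → ∑-cong L (λ s → cong f (sym (+-assoc L (i * L) s))))) ⟩
  ∑< L f + ∑[ i < k ] ∑[ s < L ] f (suc i * L + s)     ∎
  where open ≡-Reasoning

𝟙 : ∀ {P : Set} → Dec P → ℕ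
𝟙 (yes _) = 1
𝟙 (no _)  = 0

𝟙-≤ : ∀ {P : Set} {x} (P? : Dec P) → (P → 1 ≤ x) → 𝟙 P? ≤ x
𝟙-≤ (yes P) 1≤x = 1≤x P
𝟙-≤ (no _)  _   = z≤n

𝟙-yes : ∀ {P : Set} (P? : Dec P) → P → 𝟙 P? ≡ 1
𝟙-yes (yes _) _  = refl
𝟙-yes (no ¬P) P = contradiction P ¬P

length-filter-applyUpTo : ∀ {P : ℕ → Set} (P? : Decidable P) f n →
                          length (filter P? (applyUpTo f n)) ≡ ∑[ i < n ] 𝟙 (P? (f i))
length-filter-applyUpTo P? f zero = refl
length-filter-applyUpTo P? f (suc n) with P? (f 0)
... | yes _ = cong suc (length-filter-applyUpTo P? (λ i → f (suc i)) n)
... | no _  = length-filter-applyUpTo P? (λ i → f (suc i)) n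

∑-𝟙-≡-injective : ∀ n {f : ℕ → ℕ} → (∀ {i j} → i < n → j < n → f i ≡ f j → i ≡ j) →
                   ∀ v → ∑[ i < n ] 𝟙 (f i ≟ v) ≤ 1
∑-𝟙-≡-injective zero    f-inj v = z≤n
∑-𝟙-≡-injective (suc n) {f} f-inj v with f 0 ≟ v
... | no _     = ∑-𝟙-≡-injective n (λ i<n j<n eq → suc-injective (f-inj (s<s i<n) (s<s j<n) eq)) v
... | yes f0≡v = s≤s (subst (∑[ i < n ] 𝟙 (f (suc i) ≟ v) ≤_) (*-zeroʳ n) (∑-≤-* n 0 not-v))
  where
  not-v : ∀ {i} → i < n → 𝟙 (f (suc i) ≟ v) ≤ 0
  not-v {i} i<n with f (suc i) ≟ v
  ... | no _     = z≤n
  ... | yes fi≡v = contradiction (f-inj z<s (s<s i<n) (trans f0≡v (sym fi≡v))) λ ()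

∑-𝟙-<-injective : ∀ n {f : ℕ → ℕ} → (∀ {i j} → i < n → j < n → f i ≡ f j → i ≡ j) →
                   ∀ h → ∑[ i < n ] 𝟙 (f i <? h) ≤ h
∑-𝟙-<-injective n {f} f-inj zero    =
  subst (∑[ i < n ] 𝟙 (f i <? 0) ≤_) (*-zeroʳ n) (∑-≤-* n 0 (λ {i} _ → nothing-below (f i)))
  where
  nothing-below : ∀ x → 𝟙 (x <? 0) ≤ 0
  nothing-below x with x <? 0
  ... | no _ = z≤n
∑-𝟙-<-injective n {f} f-inj (suc h) = begin
  ∑[ i < n ] 𝟙 (f i <? suc h)                       ≡⟨ ∑-cong n (λ i → 𝟙-<-suc (f i)) ⟩
  ∑[ i < n ] (𝟙 (f i ≟ h) + 𝟙 (f i <? h))           ≡⟨ ∑-+ n _ _ ⟩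
  ∑[ i < n ] 𝟙 (f i ≟ h) + ∑[ i < n ] 𝟙 (f i <? h)  ≤⟨ +-mono-≤ (∑-𝟙-≡-injective n f-inj h)
                                                                 (∑-𝟙-<-injective n f-inj h) ⟩
  suc h                                             ∎
  where
  open ≤-Reasoning
  𝟙-<-suc : ∀ x → 𝟙 (x <? suc h) ≡ 𝟙 (x ≟ h) + 𝟙 (x <? h)
  𝟙-<-suc x with x <? suc h | x ≟ h | x <? h
  ... | yes _      | yes _    | no _    = refl
  ... | yes _      | no _     | yes _   = refl
  ... | no _       | no _     | no _    = refl
  ... | yes x<1+h  | no x≢h   | no x≮h  = contradiction (≤∧≮⇒≡ (≤-pred x<1+h) x≮h) x≢h
  ... | _          | yes refl | yes x<x = contradiction x<x (<-irrefl refl)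
  ... | no x≮1+h   | yes refl | _       = contradiction ≤-refl x≮1+h
  ... | no x≮1+h   | no _     | yes x<h = contradiction (m<n⇒m<1+n x<h) x≮1+h

-- g j s stands for the digit at level j of the s-th term, and L j for the step at level j.
module WindowCount (p h : ℕ) (L : ℕ → ℕ) (g : ℕ → ℕ → ℕ)
  (L-suc : ∀ j → L (suc j) ≡ p * L j)
  (g-periodic : ∀ {k j} → k < j → ∀ y i → g k (y + i * L j) ≡ g k y)
  (g-injective : ∀ j y {i i′} → i < p → i′ < p → g j (y + i * L j) ≡ g j (y + i′ * L j) → i ≡ i′)
  where

  allSmall : ℕ → ℕ → ℕ
  allSmall zero    s = 1
  allSmall (suc j) s = allSmall j s * 𝟙 (g j s <? h)

  allSmall-periodic : ∀ {k j} → k ≤ j → ∀ y i → allSmall k (y + i * L j) ≡ allSmall k y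
  allSmall-periodic {zero}  k≤j y i = refl
  allSmall-periodic {suc k} k<j y i =
    cong₂ (λ u v → u * 𝟙 (v <? h)) (allSmall-periodic (<⇒≤ k<j) y i) (g-periodic k<j y i)

  block-count : ∀ j y → ∑[ i < p ] allSmall (suc j) (y + i * L j) ≤ h * allSmall j y
  block-count j y = begin
    ∑[ i < p ] (allSmall j (y + i * L j) * 𝟙 (g j (y + i * L j) <? h))
      ≡⟨ ∑-cong p (λ i → cong (_* 𝟙 (g j (y + i * L j) <? h)) (allSmall-periodic {j} ≤-refl y i)) ⟩
    ∑[ i < p ] (allSmall j y * 𝟙 (g j (y + i * L j) <? h))
      ≡⟨ ∑-*ˡ p (allSmall j y) _ ⟩
    allSmall j y * ∑[ i < p ] 𝟙 (g j (y + i * L j) <? h)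
      ≤⟨ *-monoʳ-≤ (allSmall j y) (∑-𝟙-<-injective p (g-injective j y) h) ⟩
    allSmall j y * h
      ≡⟨ *-comm (allSmall j y) h ⟩
    h * allSmall j y ∎
    where open ≤-Reasoning

  window-count : ∀ j s₀ → ∑[ x < L j ] allSmall j (s₀ + x) ≤ L 0 * h ^ j
  window-count zero    s₀ = ∑-≤-* (L 0) 1 (λ _ → ≤-refl)
  window-count (suc j) s₀ = begin
    ∑[ x < L (suc j) ] allSmall (suc j) (s₀ + x)
      ≡⟨ cong (λ n → ∑[ x < n ] allSmall (suc j) (s₀ + x)) (L-suc j) ⟩
    ∑[ x < p * L j ] allSmall (suc j) (s₀ + x)
      ≡⟨ ∑-blocks p (L j) _ ⟩
    ∑[ i < p ] ∑[ s < L j ] allSmall (suc j) (s₀ + (i * L j + s))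
      ≡⟨ ∑-comm p (L j) _ ⟩
    ∑[ s < L j ] ∑[ i < p ] allSmall (suc j) (s₀ + (i * L j + s))
      ≡⟨ ∑-cong (L j) (λ s → ∑-cong p (λ i → cong (allSmall (suc j)) (shuffle s₀ (i * L j) s))) ⟩
    ∑[ s < L j ] ∑[ i < p ] allSmall (suc j) (s₀ + s + i * L j)
      ≤⟨ ∑-mono-≤ (L j) (λ s → block-count j (s₀ + s)) ⟩
    ∑[ s < L j ] (h * allSmall j (s₀ + s))
      ≡⟨ ∑-*ˡ (L j) h _ ⟩
    h * ∑[ s < L j ] allSmall j (s₀ + s)
      ≤⟨ *-monoʳ-≤ h (window-count j s₀) ⟩
    h * (L 0 * h ^ j)
      ≡⟨ x∙yz≈y∙xz h (L 0) (h ^ j) ⟩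
    L 0 * h ^ suc j ∎
    where
    open ≤-Reasoning
    shuffle : ∀ a b c → a + (b + c) ≡ a + c + b
    shuffle = solve-∀

  prefix-count : ∀ j a → 0 < L j → ∑< a (allSmall j) * L j ≤ (a + L j) * (L 0 * h ^ j)
  prefix-count j a L>0 = begin
    ∑< a (allSmall j) * L j
      ≤⟨ *-monoˡ-≤ (L j) (∑-mono-length (allSmall j) (<⇒≤ a<qL)) ⟩
    ∑< (q * L j) (allSmall j) * L j
      ≡⟨ cong (_* L j) (∑-blocks q (L j) (allSmall j)) ⟩
    ∑[ i < q ] ∑[ s < L j ] allSmall j (i * L j + s) * L j
      ≤⟨ *-monoˡ-≤ (L j) (∑-≤-* q (L 0 * h ^ j) (λ {i} _ → window-count j (i * L j))) ⟩
    q * (L 0 * h ^ j) * L j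
      ≡⟨ xy∙z≈xz∙y q (L 0 * h ^ j) (L j) ⟩
    q * L j * (L 0 * h ^ j)
      ≤⟨ *-monoˡ-≤ (L 0 * h ^ j) qL≤a+L ⟩
    (a + L j) * (L 0 * h ^ j) ∎
    where
    open ≤-Reasoning
    instance
      L≢0 : NonZero (L j)
      L≢0 = >-nonZero L>0
    q = suc (a / L j)
    a<qL : a < q * L j
    a<qL = begin-strict
      a                        ≡⟨ m≡m%n+[m/n]*n a (L j) ⟩
      a % L j + a / L j * L j  <⟨ +-monoˡ-< (a / L j * L j) (m%n<n a (L j)) ⟩
      L j + a / L j * L j      ∎
    qL≤a+L : q * L j ≤ a + L j
    qL≤a+L = begin
      L j + a / L j * L j ≤⟨ +-monoʳ-≤ (L j) (m/n*n≤m a (L j)) ⟩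
      L j + a             ≡⟨ +-comm (L j) a ⟩
      a + L j             ∎

numLarge≡0-∷ : ∀ p d ds → numLarge p (d ∷ ds) ≡ 0 → ¬ (p < 2 * d) × numLarge p ds ≡ 0
numLarge≡0-∷ p d ds eq with p <? 2 * d
numLarge≡0-∷ p d ds () | yes _
... | no not-large = not-large , eq

module Digits (p : ℕ) .{{_ : NonZero p}} where

  -- x /p^ l = ⌊x / p ^ l⌋, by repeated division so that no NonZero (p ^ l) instance is needed.
  infixl 7 _/p^_
  _/p^_ : ℕ → ℕ → ℕ
  x /p^ zero  = x
  x /p^ suc l = x / p /p^ l

  digit : ℕ → ℕ → ℕ
  digit l x = x /p^ l % p

  0/p^l≡0 : ∀ l → 0 /p^ l ≡ 0
  0/p^l≡0 zero    = refl
  0/p^l≡0 (suc l) = trans (cong (_/p^ l) (0/n≡0 p)) (0/p^l≡0 l)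

  [x+p^l*z]/p^l : ∀ l x z → (x + p ^ l * z) /p^ l ≡ x /p^ l + z
  [x+p^l*z]/p^l zero    x z = cong (x +_) (*-identityˡ z)
  [x+p^l*z]/p^l (suc l) x z = begin
    (x + p * p ^ l * z) / p /p^ l      ≡⟨ cong (λ v → (x + v) / p /p^ l) (xy∙z≈zx∙y p (p ^ l) z) ⟩
    (x + z * p * p ^ l) / p /p^ l      ≡⟨ cong (λ v → (x + v) / p /p^ l) (xy∙z≈xz∙y z p (p ^ l)) ⟩
    (x + z * p ^ l * p) / p /p^ l      ≡⟨ cong (_/p^ l) (+-distrib-/-∣ʳ x (n∣m*n (z * p ^ l))) ⟩
    (x / p + z * p ^ l * p / p) /p^ l  ≡⟨ cong (λ v → (x / p + v) /p^ l) (m*n/n≡m (z * p ^ l) p) ⟩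
    (x / p + z * p ^ l) /p^ l          ≡⟨ cong (λ v → (x / p + v) /p^ l) (*-comm z (p ^ l)) ⟩
    (x / p + p ^ l * z) /p^ l          ≡⟨ [x+p^l*z]/p^l l (x / p) z ⟩
    x / p /p^ l + z                    ∎
    where open ≡-Reasoning

  digit-+-at : ∀ l x z → digit l (x + p ^ l * z) ≡ (x /p^ l + z) % p
  digit-+-at l x z = cong (_% p) ([x+p^l*z]/p^l l x z)

  digit-+-above : ∀ {l m} → l < m → ∀ x z → digit l (x + p ^ m * z) ≡ digit l x
  digit-+-above {l} {m} l<m x z = begin
    digit l (x + p ^ m * z)                 ≡⟨ cong (λ v → digit l (x + p ^ v * z)) (sym l+r≡m) ⟩
    digit l (x + p ^ (l + suc r) * z)       ≡⟨ cong (λ v → digit l (x + v)) split ⟩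
    digit l (x + p ^ l * (p ^ r * z * p))   ≡⟨ digit-+-at l x (p ^ r * z * p) ⟩
    (x /p^ l + p ^ r * z * p) % p           ≡⟨ [m+kn]%n≡m%n (x /p^ l) (p ^ r * z) p ⟩
    digit l x                               ∎
    where
    open ≡-Reasoning
    r = proj₁ (m≤n⇒∃[o]m+o≡n l<m)
    l+r≡m : l + suc r ≡ m
    l+r≡m = trans (+-suc l r) (proj₂ (m≤n⇒∃[o]m+o≡n l<m))
    split : p ^ (l + suc r) * z ≡ p ^ l * (p ^ r * z * p)
    split = trans (cong (_* z) (^-distribˡ-+-* p l (suc r))) (reorder (p ^ l) p (p ^ r) z)
      where
      reorder : ∀ A p B z → A * (p * B) * z ≡ A * (B * z * p)
      reorder = solve-∀

%-+-≡⇒∣ : ∀ {p} .{{_ : NonZero p}} A B → (A + B) % p ≡ A % p → p ∣ B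
%-+-≡⇒∣ {p} A B eq = ∣m+n∣m⇒∣n (divides ((A + B) / p) (+-cancelˡ-≡ (A % p) _ _ (begin
  A % p + (A / p * p + B)        ≡⟨ sym (+-assoc (A % p) _ B) ⟩
  A % p + A / p * p + B          ≡⟨ cong (_+ B) (sym (m≡m%n+[m/n]*n A p)) ⟩
  A + B                          ≡⟨ m≡m%n+[m/n]*n (A + B) p ⟩
  (A + B) % p + (A + B) / p * p  ≡⟨ cong (_+ (A + B) / p * p) eq ⟩
  A % p + (A + B) / p * p        ∎))) (n∣m*n (A / p))
  where open ≡-Reasoning

p-valuation : ∀ {p} → 1 < p → ∀ w → 0 < w → ∃₂ λ V u → w ≡ p ^ V * u × ¬ p ∣ u
p-valuation {p} 1<p w w>0 = go w (<-wellFounded w) w>0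
  where
  go : ∀ w → Acc _<_ w → 0 < w → ∃₂ λ V u → w ≡ p ^ V * u × ¬ p ∣ u
  go w (acc smaller) w>0 with p ∣? w
  ... | no p∤w = 0 , w , sym (*-identityˡ w) , p∤w
  ... | yes (divides q refl) with go q (smaller q<qp) q>0
    where
    q>0 : 0 < q
    q>0 = >-nonZero⁻¹ q {{m*n≢0⇒m≢0 q {{>-nonZero w>0}}}}
    q<qp : q < q * p
    q<qp = m<m*n q p {{>-nonZero q>0}} 1<p
  ... | V , u , refl , p∤u = suc V , u , xy∙z≈zx∙y (p ^ V) u p , p∤u

binomial-mod² : ∀ Y i → ∃ λ R → (1 + Y) ^ i ≡ 1 + i * Y + Y * Y * R
binomial-mod² Y zero    = 0 , sym (cong suc (*-zeroʳ (Y * Y)))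
binomial-mod² Y (suc i) with R , eq ← binomial-mod² Y i =
  i + R + Y * R , trans (cong ((1 + Y) *_) eq) (expand Y i R)
  where
  expand : ∀ Y i R → (1 + Y) * (1 + i * Y + Y * Y * R) ≡ 1 + suc i * Y + Y * Y * (i + R + Y * R)
  expand = solve-∀

[1+n]C2 : ∀ n → suc n C 2 ≡ n + n C 2
[1+n]C2 n = trans (sym (nCk+nC[k+1]≡[n+1]C[k+1] n 1)) (cong (_+ n C 2) (nC1≡n n))

binomial-mod³ : ∀ Y i → ∃ λ R → (1 + Y) ^ i ≡ 1 + i * Y + (i C 2) * (Y * Y) + Y * Y * Y * R
binomial-mod³ Y zero    = 0 , sym (cong suc (*-zeroʳ (Y * Y * Y)))
binomial-mod³ Y (suc i) with R , eq ← binomial-mod³ Y i =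
  i C 2 + R + Y * R , (begin
    (1 + Y) * (1 + Y) ^ i
      ≡⟨ cong ((1 + Y) *_) eq ⟩
    (1 + Y) * (1 + i * Y + (i C 2) * (Y * Y) + Y * Y * Y * R)
      ≡⟨ expand Y i (i C 2) R ⟩
    1 + suc i * Y + (i + i C 2) * (Y * Y) + Y * Y * Y * (i C 2 + R + Y * R)
      ≡⟨ cong (λ c → 1 + suc i * Y + c * (Y * Y) + Y * Y * Y * (i C 2 + R + Y * R)) (sym ([1+n]C2 i)) ⟩
    1 + suc i * Y + (suc i C 2) * (Y * Y) + Y * Y * Y * (i C 2 + R + Y * R) ∎)
  where
  open ≡-Reasoning
  expand : ∀ Y i c R → (1 + Y) * (1 + i * Y + c * (Y * Y) + Y * Y * Y * R)
                     ≡ 1 + suc i * Y + (i + c) * (Y * Y) + Y * Y * Y * (c + R + Y * R)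
  expand = solve-∀

2*nC2+n≡n*n : ∀ n → 2 * (n C 2) + n ≡ n * n
2*nC2+n≡n*n zero    = refl
2*nC2+n≡n*n (suc n) = begin
  2 * (suc n C 2) + suc n        ≡⟨ cong (λ c → 2 * c + suc n) ([1+n]C2 n) ⟩
  2 * (n + n C 2) + suc n        ≡⟨ regroup n (n C 2) ⟩
  2 * (n C 2) + n + suc (2 * n)  ≡⟨ cong (_+ suc (2 * n)) (2*nC2+n≡n*n n) ⟩
  n * n + suc (2 * n)            ≡⟨ square n ⟩
  suc n * suc n                  ∎
  where
  open ≡-Reasoning
  regroup : ∀ n c → 2 * (n + c) + suc n ≡ 2 * c + n + suc (2 * n)
  regroup = solve-∀
  square : ∀ n → n * n + suc (2 * n) ≡ suc n * suc n
  square = solve-∀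

module OddPrime (t : ℕ) (p-prime : Prime (suc (2 * t))) where

  p : ℕ
  p = suc (2 * t)

  open Digits p

  p+1≡2[t+1] : p + 1 ≡ 2 * suc t
  p+1≡2[t+1] = odd+1 t
    where
    odd+1 : ∀ t → suc (2 * t) + 1 ≡ 2 * suc t
    odd+1 = solve-∀

  p>1 : 1 < p
  p>1 = nonTrivial⇒n>1 p {{prime⇒nonTrivial p-prime}}

  p∤1 : ¬ p ∣ 1
  p∤1 p∣1 = <-irrefl (sym (∣1⇒≡1 p∣1)) p>1

  p∤-* : ∀ {a b} → ¬ p ∣ a → ¬ p ∣ b → ¬ p ∣ a * b
  p∤-* {a} {b} p∤a p∤b p∣ab = [ p∤a , p∤b ]′ (euclidsLemma a b p-prime p∣ab)

  p∤^ : ∀ {a} → ¬ p ∣ a → ∀ n → ¬ p ∣ a ^ n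
  p∤^ p∤a zero    = p∤1
  p∤^ p∤a (suc n) = p∤-* p∤a (p∤^ p∤a n)

  p∤+p* : ∀ {u} → ¬ p ∣ u → ∀ v → ¬ p ∣ u + p * v
  p∤+p* {u} p∤u v p∣ = p∤u (∣m+n∣m⇒∣n (subst (p ∣_) (+-comm u (p * v)) p∣) (m∣m*n v))

  distinct-residues : ∀ {A c i j} → ¬ p ∣ c → i < j → j < p → (A + j * c) % p ≢ (A + i * c) % p
  distinct-residues {A} {c} {i} p∤c i<j j<p eq with δ , refl ← m≤n⇒∃[o]m+o≡n (<⇒≤ i<j) =
    [ p∤δ , p∤c ]′ (euclidsLemma δ c p-prime (%-+-≡⇒∣ (A + i * c) (δ * c) (trans (cong (_% p) (split A i δ c)) eq)))
    where
    split : ∀ A i δ c → A + i * c + δ * c ≡ A + (i + δ) * c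
    split = solve-∀
    δ>0 : ∀ δ → i < i + δ → 0 < δ
    δ>0 zero    i<i+0 = contradiction (subst (i <_) (+-identityʳ i) i<i+0) (<-irrefl refl)
    δ>0 (suc _) _     = z<s
    p∤δ : ¬ p ∣ δ
    p∤δ p∣δ = <⇒≱ j<p (≤-trans (∣⇒≤ {{>-nonZero (δ>0 δ i<j)}} p∣δ) (m≤n+m δ i))

  affine-%-injective : ∀ {A c i j} → ¬ p ∣ c → i < p → j < p → (A + i * c) % p ≡ (A + j * c) % p → i ≡ j
  affine-%-injective {A} {c} {i} {j} p∤c i<p j<p eq with <-cmp i j
  ... | tri< i<j _ _ = contradiction (sym eq) (distinct-residues {A} {c} p∤c i<j j<p)
  ... | tri≈ _ i≡j _ = i≡j
  ... | tri> _ _ j<i = contradiction eq (distinct-residues {A} {c} p∤c j<i i<p)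

  pC2≡p*t : p C 2 ≡ p * t
  pC2≡p*t = *-cancelˡ-≡ (p C 2) (p * t) 2 (+-cancelʳ-≡ p _ _ (trans (2*nC2+n≡n*n p) (odd-square t)))
    where
    odd-square : ∀ t → suc (2 * t) * suc (2 * t) ≡ 2 * (suc (2 * t) * t) + suc (2 * t)
    odd-square = solve-∀

  -- The quadratic term is harmless because p ∣ p C 2, which is where p odd is used.
  lift-exponent : ∀ w u → ∃ λ v → (1 + p ^ suc w * u) ^ p ≡ 1 + p ^ suc (suc w) * (u + p * v)
  lift-exponent w u with R , eq ← binomial-mod³ (p ^ suc w * u) p =
    t * p ^ w * u * u + p ^ w * p ^ w * u * u * u * R , (begin
      (1 + Y) ^ p
        ≡⟨ eq ⟩
      1 + p * Y + (p C 2) * (Y * Y) + Y * Y * Y * R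
        ≡⟨ cong (λ c → 1 + p * Y + c * (Y * Y) + Y * Y * Y * R) pC2≡p*t ⟩
      1 + p * Y + p * t * (Y * Y) + Y * Y * Y * R
        ≡⟨ collect p (p ^ w) t u R ⟩
      1 + p ^ suc (suc w) * (u + p * (t * p ^ w * u * u + p ^ w * p ^ w * u * u * u * R)) ∎)
    where
    open ≡-Reasoning
    Y = p ^ suc w * u
    collect : ∀ p P t u R →
      1 + p * (p * P * u) + p * t * (p * P * u * (p * P * u)) + p * P * u * (p * P * u) * (p * P * u) * R
      ≡ 1 + p * (p * P) * (u + p * (t * P * u * u + P * P * u * u * u * R))
    collect = solve-∀

  *-[1+p^[1+w]*c]^i : ∀ x w c i → ∃ λ K → x * (1 + p ^ suc w * c) ^ i ≡ x + p ^ suc w * (i * (x * c) + K * p)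
  *-[1+p^[1+w]*c]^i x w c i with R , eq ← binomial-mod² (p ^ suc w * c) i =
    x * c * (p ^ w * c * R) , trans (cong (x *_) eq) (expand x i p (p ^ w) c R)
    where
    expand : ∀ x i p P c R → x * (1 + i * (p * P * c) + p * P * c * (p * P * c) * R)
                           ≡ x + p * P * (i * (x * c) + x * c * (P * c * R) * p)
    expand = solve-∀

  not-large⇒small : ∀ d → ¬ (p < 2 * d) → d < suc t
  not-large⇒small d not-large =
    *-cancelˡ-< 2 d (suc t) (subst (2 * d <_) (trans (+-comm 1 p) p+1≡2[t+1]) (s≤s (≮⇒≥ not-large)))

  digitsF-small : ∀ f x → x ≤ f → numLarge p (digitsF p f x) ≡ 0 → ∀ l → digit l x < suc t
  digitsF-small f       zero    _   _    l = subst (_< suc t) (sym (cong (_% p) (0/p^l≡0 l))) z<s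
  digitsF-small (suc f) (suc x) x≤f none l with not-large , rest ← numLarge≡0-∷ p (suc x % p) _ none with l
  ... | zero  = not-large⇒small (suc x % p) not-large
  ... | suc l = digitsF-small f (suc x / p) (≤-pred (≤-trans (m/n<m (suc x) p p>1) x≤f)) rest l

  module Powers (α : ℕ) (1<α : 1 < α) (p∤α : ¬ p ∣ α) where

    instance
      α≢0 : NonZero α
      α≢0 = >-nonZero (<⇒≤ 1<α)

    cancel-power-mod-p : ∀ I d → α ^ (I + d) % p ≡ α ^ I % p → ∃ λ q → α ^ d ≡ 1 + q * p
    cancel-power-mod-p I d same = quotient p∣w , trans (sym 1+w≡α^d) (cong suc (m∣n⇒n≡quotient*m p∣w))
      where
      w = proj₁ (m≤n⇒∃[o]m+o≡n (m^n>0 α d))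
      1+w≡α^d : 1 + w ≡ α ^ d
      1+w≡α^d = proj₂ (m≤n⇒∃[o]m+o≡n (m^n>0 α d))
      split : α ^ (I + d) ≡ α ^ I + α ^ I * w
      split = begin
        α ^ (I + d)           ≡⟨ ^-distribˡ-+-* α I d ⟩
        α ^ I * α ^ d         ≡⟨ cong (α ^ I *_) (sym 1+w≡α^d) ⟩
        α ^ I * (1 + w)       ≡⟨ *-distribˡ-+ (α ^ I) 1 w ⟩
        α ^ I * 1 + α ^ I * w ≡⟨ cong (_+ α ^ I * w) (*-identityʳ (α ^ I)) ⟩
        α ^ I + α ^ I * w     ∎
        where open ≡-Reasoning
      p∣w : p ∣ w
      p∣w = [ (λ p∣α^I → contradiction p∣α^I (p∤^ p∤α I)) , id ]′
        (euclidsLemma (α ^ I) w p-prime (%-+-≡⇒∣ (α ^ I) (α ^ I * w) (subst (λ x → x % p ≡ α ^ I % p) split same)))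

    repeat⇒power≡1-mod-p : ∀ {I J} → I < J → α ^ J % p ≡ α ^ I % p →
                            ∃ λ d → 1 ≤ d × d ≤ J × ∃ λ q → α ^ d ≡ 1 + q * p
    repeat⇒power≡1-mod-p {I} I<J same with d , refl ← m≤n⇒∃[o]m+o≡n (<⇒≤ I<J) =
      d , +-cancelˡ-< I 0 d (subst (_< I + d) (sym (+-identityʳ I)) I<J) , m≤n+m d I , cancel-power-mod-p I d same

    residue : Fin (suc p) → Fin p
    residue i = fromℕ< (m%n<n (α ^ toℕ i) p)

    residues-agree : ∀ {i j} → residue i ≡ residue j → α ^ toℕ j % p ≡ α ^ toℕ i % p
    residues-agree {i} {j} same = trans (sym (Finₚ.toℕ-fromℕ< (m%n<n (α ^ toℕ j) p)))
      (trans (cong toℕ (sym same)) (Finₚ.toℕ-fromℕ< (m%n<n (α ^ toℕ i) p)))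

    power≡1-mod-p : ∃ λ d → 1 ≤ d × d ≤ p × ∃ λ q → α ^ d ≡ 1 + q * p
    power≡1-mod-p with i , j , i<j , same ← Finₚ.pigeonhole (n<1+n p) residue
      with d , 1≤d , d≤j , rest ← repeat⇒power≡1-mod-p i<j (residues-agree {i} {j} same) =
      d , 1≤d , ≤-trans d≤j (≤-pred (Finₚ.toℕ<n j)) , rest

    quotient-positive : ∀ {d q} → 1 ≤ d → α ^ d ≡ 1 + q * p → 0 < q
    quotient-positive {d} {zero}  1≤d α^d≡1 =
      contradiction α^d≡1 (>⇒≢ (≤-trans 1<α (subst (_≤ α ^ d) (*-identityʳ α) (^-monoʳ-≤ α 1≤d))))
    quotient-positive {q = suc _} _ _ = z<s

    -- Opaque: unfolding the pigeonhole search behind this witness makes type checking very slow.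
    opaque
      lifting-base : ∃ λ d → 1 ≤ d × d ≤ p × ∃₂ λ V u → α ^ d ≡ 1 + p ^ suc V * u × ¬ p ∣ u
      lifting-base = base power≡1-mod-p
        where
        base : (∃ λ d → 1 ≤ d × d ≤ p × ∃ λ q → α ^ d ≡ 1 + q * p) →
               ∃ λ d → 1 ≤ d × d ≤ p × ∃₂ λ V u → α ^ d ≡ 1 + p ^ suc V * u × ¬ p ∣ u
        base (d , 1≤d , d≤p , q , α^d≡) =
          let V , u , q≡ , p∤u = p-valuation p>1 q (quotient-positive 1≤d α^d≡)
          in d , 1≤d , d≤p , V , u , trans α^d≡ (cong suc (trans (cong (_* p) q≡) (xy∙z≈zx∙y (p ^ V) u p))) , p∤u

    module Lifted (d V u : ℕ) (1≤d : 1 ≤ d) (d≤p : d ≤ p)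
                  (α^d≡ : α ^ d ≡ 1 + p ^ suc V * u) (p∤u : ¬ p ∣ u) where

      tower : ∀ j → ∃ λ v → α ^ (d * p ^ j) ≡ 1 + p ^ suc (V + j) * (u + p * v)
      tower zero    = 0 , (begin
        α ^ (d * 1)                        ≡⟨ cong (α ^_) (*-identityʳ d) ⟩
        α ^ d                              ≡⟨ α^d≡ ⟩
        1 + p ^ suc V * u                  ≡⟨ cong₂ (λ k x → 1 + p ^ suc k * x) (sym (+-identityʳ V)) (sym u+p*0≡u) ⟩
        1 + p ^ suc (V + 0) * (u + p * 0)  ∎)
        where
        open ≡-Reasoning
        u+p*0≡u : u + p * 0 ≡ u
        u+p*0≡u = trans (cong (u +_) (*-zeroʳ p)) (+-identityʳ u)
      tower (suc j) =
        let v , eq = tower j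
            v′ , eq′ = lift-exponent (V + j) (u + p * v)
        in v + v′ , (begin
        α ^ (d * (p * p ^ j))                             ≡⟨ cong (α ^_) (x∙yz≈xz∙y d p (p ^ j)) ⟩
        α ^ (d * p ^ j * p)                               ≡⟨ sym (^-*-assoc α (d * p ^ j) p) ⟩
        (α ^ (d * p ^ j)) ^ p                             ≡⟨ cong (_^ p) eq ⟩
        (1 + p ^ suc (V + j) * (u + p * v)) ^ p           ≡⟨ eq′ ⟩
        1 + p ^ suc (suc (V + j)) * (u + p * v + p * v′)
          ≡⟨ cong₂ (λ k x → 1 + p ^ suc k * x) (sym (+-suc V j))
                   (trans (+-assoc u (p * v) (p * v′)) (cong (u +_) (sym (*-distribˡ-+ p v v′)))) ⟩
        1 + p ^ suc (V + suc j) * (u + p * (v + v′))      ∎)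
        where open ≡-Reasoning

      L : ℕ → ℕ
      L j = d * p ^ j

      L-suc : ∀ j → L (suc j) ≡ p * L j
      L-suc j = x∙yz≈y∙xz d p (p ^ j)

      unit : ℕ → ℕ
      unit j = u + p * proj₁ (tower j)

      α^[y+i*L] : ∀ j y i → α ^ (y + i * L j) ≡ α ^ y * (1 + p ^ suc (V + j) * unit j) ^ i
      α^[y+i*L] j y i = begin
        α ^ (y + i * L j)                       ≡⟨ ^-distribˡ-+-* α y (i * L j) ⟩
        α ^ y * α ^ (i * L j)                   ≡⟨ cong (λ e → α ^ y * α ^ e) (*-comm i (L j)) ⟩
        α ^ y * α ^ (L j * i)                   ≡⟨ cong (α ^ y *_) (sym (^-*-assoc α (L j) i)) ⟩
        α ^ y * (α ^ L j) ^ i                   ≡⟨ cong (λ x → α ^ y * x ^ i) (proj₂ (tower j)) ⟩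
        α ^ y * (1 + p ^ suc (V + j) * unit j) ^ i ∎
        where open ≡-Reasoning

      α^[y+i*L]-mod : ∀ j y i → ∃ λ K → α ^ (y + i * L j) ≡ α ^ y + p ^ suc (V + j) * (i * (α ^ y * unit j) + K * p)
      α^[y+i*L]-mod j y i =
        let K , eq = *-[1+p^[1+w]*c]^i (α ^ y) (V + j) (unit j) i in K , trans (α^[y+i*L] j y i) eq

      g : ℕ → ℕ → ℕ
      g j s = digit (suc (V + j)) (α ^ s)

      g-periodic : ∀ {k j} → k < j → ∀ y i → g k (y + i * L j) ≡ g k y
      g-periodic {k} {j} k<j y i =
        let K , eq = α^[y+i*L]-mod j y i in
        trans (cong (digit (suc (V + k))) eq) (digit-+-above (s<s (+-monoʳ-< V k<j)) (α ^ y) _)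

      g-affine : ∀ j y i → g j (y + i * L j) ≡ (α ^ y /p^ suc (V + j) + i * (α ^ y * unit j)) % p
      g-affine j y i =
        let K , eq = α^[y+i*L]-mod j y i in
        trans (cong (digit (suc (V + j))) eq)
        (trans (digit-+-at (suc (V + j)) (α ^ y) _)
        (trans (cong (_% p) (sym (+-assoc (α ^ y /p^ suc (V + j)) _ (K * p))))
               ([m+kn]%n≡m%n (α ^ y /p^ suc (V + j) + i * (α ^ y * unit j)) K p)))

      g-injective : ∀ j y {i i′} → i < p → i′ < p → g j (y + i * L j) ≡ g j (y + i′ * L j) → i ≡ i′
      g-injective j y {i} {i′} i<p i′<p eq =
        affine-%-injective {α ^ y /p^ suc (V + j)} {α ^ y * unit j} (p∤-* (p∤^ p∤α y) (p∤+p* p∤u (proj₁ (tower j)))) i<p i′<p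
          (trans (sym (g-affine j y i)) (trans eq (g-affine j y i′)))

      open WindowCount p (suc t) L g L-suc g-periodic g-injective

      good⇒allSmall : ∀ {s} → numLarge p (digits p (α ^ s)) ≡ 0 → ∀ J → allSmall J s ≡ 1
      good⇒allSmall     none zero    = refl
      good⇒allSmall {s} none (suc J) = cong₂ _*_ (good⇒allSmall none J)
        (𝟙-yes (g J s <? suc t) (digitsF-small (α ^ s) (α ^ s) ≤-refl none (suc (V + J))))

      S≤∑allSmall : ∀ a J → S p α 1 a ≤ ∑< a (allSmall J)
      S≤∑allSmall a J = begin
        S p α 1 a              ≡⟨ length-filter-applyUpTo good? id a ⟩
        ∑[ s < a ] 𝟙 (good? s) ≤⟨ ∑-mono-≤ a (λ s → 𝟙-≤ (good? s) (λ n<1 → ≤-reflexive (sym (good⇒allSmall (n<1⇒n≡0 n<1) J)))) ⟩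
        ∑< a (allSmall J)      ∎
        where
        open ≤-Reasoning
        good? : ∀ s → Dec (numLarge p (digits p (α ^ s)) < 1)
        good? s = numLarge p (digits p (α ^ s)) <? 1

      prefix-bound : ∀ a J → S p α 1 a * p ^ J ≤ (a + p ^ suc J) * suc t ^ J
      prefix-bound a J = *-cancelˡ-≤ d {{>-nonZero 1≤d}} (begin
        d * (S p α 1 a * p ^ J)              ≡⟨ x∙yz≈y∙xz d (S p α 1 a) (p ^ J) ⟩
        S p α 1 a * L J                      ≤⟨ *-monoˡ-≤ (L J) (S≤∑allSmall a J) ⟩
        ∑< a (allSmall J) * L J              ≤⟨ prefix-count J a (*-mono-≤ 1≤d (m^n>0 p J)) ⟩
        (a + L J) * (L 0 * suc t ^ J)        ≤⟨ *-monoˡ-≤ (L 0 * suc t ^ J) (+-monoʳ-≤ a (*-monoˡ-≤ (p ^ J) d≤p)) ⟩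
        (a + p ^ suc J) * (L 0 * suc t ^ J)  ≡⟨ cong (λ x → (a + p ^ suc J) * (x * suc t ^ J)) (*-identityʳ d) ⟩
        (a + p ^ suc J) * (d * suc t ^ J)    ≡⟨ x∙yz≈y∙xz (a + p ^ suc J) d (suc t ^ J) ⟩
        d * ((a + p ^ suc J) * suc t ^ J)    ∎)
        where open ≤-Reasoning

    scale-bound : ∀ a k → S p α 1 a * p ^ k ≤ 2 * suc t ^ k * (a + p ^ k)
    scale-bound a zero    = begin
      S p α 1 a * 1    ≡⟨ *-identityʳ _ ⟩
      S p α 1 a        ≤⟨ length-filter (λ s → numLarge p (digits p (α ^ s)) <? 1) (upTo a) ⟩
      length (upTo a)  ≡⟨ length-upTo a ⟩
      a                ≤⟨ m≤m+n a 1 ⟩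
      a + 1            ≤⟨ m≤m+n (a + 1) _ ⟩
      2 * 1 * (a + 1)  ∎
      where open ≤-Reasoning
    scale-bound a (suc J) = let d , 1≤d , d≤p , V , u , α^d≡ , p∤u = lifting-base in begin
      S p α 1 a * (p * p ^ J)                    ≡⟨ x∙yz≈y∙xz (S p α 1 a) p (p ^ J) ⟩
      p * (S p α 1 a * p ^ J)                    ≤⟨ *-monoʳ-≤ p (Lifted.prefix-bound d V u 1≤d d≤p α^d≡ p∤u a J) ⟩
      p * ((a + p ^ suc J) * suc t ^ J)          ≤⟨ *-monoˡ-≤ _ (subst (p ≤_) p+1≡2[t+1] (m≤m+n p 1)) ⟩
      2 * suc t * ((a + p ^ suc J) * suc t ^ J)  ≡⟨ reorder (suc t) (suc t ^ J) (a + p ^ suc J) ⟩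
      2 * suc t ^ suc J * (a + p ^ suc J)        ∎
      where
      open ≤-Reasoning
      reorder : ∀ h H A → 2 * h * (A * H) ≡ 2 * (h * H) * A
      reorder = solve-∀

odd-prime : ∀ {p} → Prime p → p ≢ 2 → ∃ λ t → p ≡ suc (2 * t)
odd-prime {p} p-prime p≢2 with p % 2 | m%n<n p 2 | m≡m%n+[m/n]*n p 2
... | 0           | _             | p≡[p/2]*2   =
  [ (λ ()) , (λ 2≡p → contradiction (sym 2≡p) p≢2) ]′ (prime⇒irreducible p-prime (divides (p / 2) p≡[p/2]*2))
... | 1           | _             | p≡1+[p/2]*2 = p / 2 , trans p≡1+[p/2]*2 (cong suc (*-comm (p / 2) 2))
... | suc (suc _) | s≤s (s≤s ()) | _

gcd≡1⇒∤ : ∀ {α p} → 1 < p → gcd α p ≡ 1 → ¬ p ∣ α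
gcd≡1⇒∤ 1<p gcd≡1 p∣α = <-irrefl (sym (∣1⇒≡1 (subst (_ ∣_) gcd≡1 (gcd-greatest p∣α ∣-refl)))) 1<p

theorem2p14 : (p α : ℕ) → Prime p → p ≢ 2 → 1 < α → gcd α p ≡ 1 →
    (a : ℕ) → 1 ≤ a → LeFourPowLog (S p α 1 a) a p
theorem2p14 p α p-prime p≢2 1<α gcd≡1 a _ with odd-prime p-prime p≢2
... | t , refl = scale-bounds⇒LeFourPowLog p (suc t) (S p α 1 a) a z<s p+1≡2[t+1]
                   (scale-bound α 1<α (gcd≡1⇒∤ p>1 gcd≡1) a)
  where open OddPrime t p-prime using (p+1≡2[t+1]; p>1; module Powers)
        open Powers using (scale-bound)
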